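{- Let $m,n$ be integers with $m,n\geq 1$ and let $0\leq k\leq n-1$. Then $|\mathcal{D}^m_n|=|\mathcal{D}^{m,k}_n|$; that is, the number of $k$-skeletal paths of height $n$ with values in $\mathbb{Z}$ for parameters $c=1$ and $m$ equals the number of augmented $m$-Dyck paths of height $n$ (and the paper gives an explicit bijection between these sets).
   Context: $\mathcal{D}^m_n$ (augmented $m$-Dyck paths of height $n$) is the set of lattice paths from $(0,0)$ to $(mn+1,n)$ consisting of unit north steps and unit east steps such that every lattice point visited before the last step satisfies $x\leq my$ (the path stays weakly above the line $x=my$), and the last step is an east step ending at $(mn+1,n)$. A path of height $n$ with values in $\mathbb{Z}$ is a set $\pi=\{(x_i,i):0\leq i\leq n-1\}$ with integers $x_0\leq\cdots\leq x_{n-1}$; it is $k$-skeletal for parameters $c=1$ and $m$ iff (P0) $x_0\geq 0$; (P1) $x_i<mi+1$ for all $i\in\{n-k-1,\ldots,n-1\}$; (P2) for every $i\in\{0,\ldots,n-k-1\}$ there is $j\in\{i,\ldots,i+k\}$ with $x_j\geq mj$. Such a path is identified with the lattice path from $(0,0)$ to $(mn,n)$ whose north steps go from $(x_i,i)$ to $(x_i,i+1)$, augmented with one final east step to $(mn+1,n)$; $\mathcal{D}^{m,k}_n$ is the set of these augmented paths. -}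

module Defs where

open import Data.Nat as ℕ using (ℕ; zero; suc; _+_; _*_; _∸_)
open import Data.Integer as ℤ using (ℤ; +_)
open import Data.Fin using (Fin; toℕ)
open import Data.Vec using (Vec; lookup)
open import Data.List using (List; []; _∷_; _++_)
open import Data.Product using (Σ; ∃; _×_; proj₁)
open import Relation.Binary.PropositionalEquality using (_≡_)

data Step : Set where
  N E : Step

#N : List Step → ℕ
#N []       = 0
#N (N ∷ s)  = suc (#N s)
#N (E ∷ s)  = #N s

#E : List Step → ℕ
#E []       = 0
#E (N ∷ s)  = #E s
#E (E ∷ s)  = suc (#E s)

-- Augmented m-Dyck path of height n: a path from (0,0) to (mn+1,n)
-- whose last step is east, i.e. s = p ++ [E], where p goes from (0,0)
-- to (mn,n), and every lattice point visited before the last step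
-- (= the endpoint of every prefix q of p, including [] and p) satisfies
-- x ≤ m y.
IsAugDyck : (m n : ℕ) → List Step → Set
IsAugDyck m n s =
  Σ (List Step) λ p →
    (s ≡ p ++ (E ∷ [])) ×
    (#N p ≡ n) ×
    (#E p + 1 ≡ m * n + 1) ×
    (∀ (q r : List Step) → q ++ r ≡ p → #E q ℕ.≤ m * #N q)

-- k-skeletal paths of height n with values in ℤ, for c = 1 and m.
-- The path π = {(x_i , i) : 0 ≤ i ≤ n-1} is given by x = (x_0,…,x_{n-1}).
IsSkeletal : (m n k : ℕ) → Vec ℤ n → Set
IsSkeletal m n k x =
  (∀ (i j : Fin n) → toℕ i ℕ.≤ toℕ j → lookup x i ℤ.≤ lookup x j) ×
  (∀ (i : Fin n) → toℕ i ≡ 0 → + 0 ℤ.≤ lookup x i) ×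
  (∀ (i : Fin n) → n ∸ k ∸ 1 ℕ.≤ toℕ i →
      lookup x i ℤ.< + (m * toℕ i) ℤ.+ + 1) ×
  (∀ (i : ℕ) → i ℕ.≤ n ∸ k ∸ 1 →
      ∃ λ (j : Fin n) → (i ℕ.≤ toℕ j) × (toℕ j ℕ.≤ i + k) ×
                        (+ (m * toℕ j) ℤ.≤ lookup x j))

-- Equinumerosity of two subsets {a : A | P a} and {b : B | Q b}:
-- a bijection between the underlying elements (proofs of P, Q are
-- ignored: maps must respect and invert the underlying data).

record SameCard {A B : Set} (P : A → Set) (Q : B → Set) : Set where
  field
    to        : Σ A P → Σ B Q
    from      : Σ B Q → Σ A P
    to-cong   : ∀ a a′ → proj₁ a ≡ proj₁ a′ → proj₁ (to a) ≡ proj₁ (to a′)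
    from-cong : ∀ b b′ → proj₁ b ≡ proj₁ b′ → proj₁ (from b) ≡ proj₁ (from b′)
    from-to   : ∀ a → proj₁ (from (to a)) ≡ proj₁ a
    to-from   : ∀ b → proj₁ (to (from b)) ≡ proj₁ b

-- Record a path by its excess e i = x i − m i, where x i is the abscissa of its
-- i-th north step, and extend e to ℕ by e (i + n) = e i + 1.  The extension drops
-- by at most m per step, and both kinds of paths are windows of length n of such
-- functions: an augmented m-Dyck path is a window starting at a point where the
-- extension vanishes and is maximal on the window, a k-skeletal path is the window
-- starting at the greatest anchor, a point w where the extension is nonnegative
-- but negative at the k + 1 points before w.  Moving a Dyck window to the greatest
-- anchor of its extension, and a skeletal window to its first maximum (shifted
-- down to 0), are mutually inverse.

module Submission where

open import Defs
open import Data.Empty using (⊥; ⊥-elim)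
open import Data.Fin as Fin using (Fin; toℕ; fromℕ<)
open import Data.Fin.Properties using (toℕ<n; toℕ-fromℕ<)
open import Data.Integer as ℤ using (ℤ; +_; 0ℤ; 1ℤ)
import Data.Integer.Properties as ℤ
open import Data.Integer.Tactic.RingSolver using (solve-∀)
open import Data.List using (List; []; _∷_; _++_; _∷ʳ_; length; replicate; applyUpTo)
open import Data.List.Properties using (++-identityʳ; length-applyUpTo)
open import Data.Nat using (ℕ; zero; suc; pred; _+_; _*_; _∸_; _≤_; _<_; z≤n; s≤s; s≤s⁻¹; NonZero)
open import Data.Nat.DivMod
  using (_%_; _/_; m≡m%n+[m/n]*n; [m+n]%n≡m%n; m%n<n; m<n⇒m%n≡m; m<n⇒m/n≡0; m/n≡1+[m∸n]/n; m<n*o⇒m/o<n)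
open import Data.Nat.Induction using (<-rec)
open import Data.Nat.Properties
open import Data.Product using (Σ; ∃; ∃-syntax; _×_; _,_; proj₁; proj₂)
open import Data.Sum using (inj₁; inj₂)
open import Data.Vec using (Vec; []; _∷_; lookup; tabulate)
open import Data.Vec.Properties using (lookup∘tabulate; tabulate∘lookup; tabulate-cong)
open import Function using (_∘_)
open import Function.Bundles using (Inverse)
open import Function.Consequences.Setoid using (strictlyInverseˡ⇒inverseˡ; strictlyInverseʳ⇒inverseʳ)
import Function.Construct.Composition as Composition
import Function.Construct.Symmetry as Symmetry
open import Level using (0ℓ)
open import Relation.Binary.Bundles using (Setoid)
import Relation.Binary.Construct.On as On
open import Relation.Binary.Definitions using (tri<; tri≈; tri>)
open import Relation.Binary.PropositionalEquality as ≡
  using (_≡_; refl; sym; trans; cong; cong₂; subst; subst₂)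
open import Relation.Nullary using (¬_; yes; no)
open import Relation.Nullary.Decidable using (_×-dec_; _→-dec_)
open import Relation.Unary using (Decidable)

open import Algebra.Properties.CommutativeSemigroup +-commutativeSemigroup using (xy∙z≈xz∙y)
import Algebra.Properties.CommutativeSemigroup ℤ.+-commutativeSemigroup as ℤ+
import Algebra.Properties.AbelianGroup ℤ.+-0-abelianGroup as ℤ+G

Subset : (S : Setoid 0ℓ 0ℓ) → (Setoid.Carrier S → Set) → Setoid 0ℓ 0ℓ
Subset S P = On.setoid {B = Σ (Setoid.Carrier S) P} S proj₁

module _ {S T : Setoid 0ℓ 0ℓ} where
  open Setoid S using () renaming (Carrier to A; _≈_ to _≈₁_)
  open Setoid T using () renaming (Carrier to B; _≈_ to _≈₂_)

  mkInverse : (to : A → B) (from : B → A) →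
              (∀ {x x′} → x ≈₁ x′ → to x ≈₂ to x′) →
              (∀ {y y′} → y ≈₂ y′ → from y ≈₁ from y′) →
              (∀ y → to (from y) ≈₂ y) → (∀ x → from (to x) ≈₁ x) → Inverse S T
  mkInverse to from to-cong from-cong to-from from-to = record
    { to        = to
    ; from      = from
    ; to-cong   = to-cong
    ; from-cong = from-cong
    ; inverse   = strictlyInverseˡ⇒inverseˡ S T to-cong to-from
                , strictlyInverseʳ⇒inverseʳ S T from-cong from-to
    }

  restrict : {P : A → Set} {Q : B → Set} (I : Inverse S T) →
             (∀ {x} → P x → Q (Inverse.to I x)) → (∀ {y} → Q y → P (Inverse.from I y)) →
             Inverse (Subset S P) (Subset T Q)
  restrict I P⇒Q Q⇒P = record
    { to        = λ (x , p) → to x , P⇒Q p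
    ; from      = λ (y , q) → from y , Q⇒P q
    ; to-cong   = to-cong
    ; from-cong = from-cong
    ; inverse   = inverseˡ , inverseʳ
    } where open Inverse I

infixr 9 _⨾_
_⨾_ : {R S T : Setoid 0ℓ 0ℓ} → Inverse R S → Inverse S T → Inverse R T
_⨾_ = Composition.inverse

sameCard : {A B : Set} {P : A → Set} {Q : B → Set} →
           Inverse (Subset (≡.setoid A) P) (Subset (≡.setoid B) Q) → SameCard P Q
sameCard I = record
  { to        = to
  ; from      = from
  ; to-cong   = λ _ _ → to-cong
  ; from-cong = λ _ _ → from-cong
  ; from-to   = λ _ → inverseʳ refl
  ; to-from   = λ _ → inverseˡ refl
  } where open Inverse I

-- Sequences of length n, represented by functions on ℕ

_≗[_]_ : {A : Set} → (ℕ → A) → ℕ → (ℕ → A) → Set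
f ≗[ n ] g = ∀ i → i < n → f i ≡ g i

Seq : ℕ → Set → Setoid 0ℓ 0ℓ
Seq n A = record
  { Carrier       = ℕ → A
  ; _≈_           = _≗[ n ]_
  ; isEquivalence = record
    { refl  = λ _ _ → refl
    ; sym   = λ f≗g i i<n → sym (f≗g i i<n)
    ; trans = λ f≗g g≗h i i<n → trans (f≗g i i<n) (g≗h i i<n)
    }
  }

translate : ∀ n → (ℕ → ℤ) → Inverse (Seq n ℤ) (Seq n ℤ)
translate n c = mkInverse (λ f i → f i ℤ.+ c i) (λ g i → g i ℤ.- c i)
  (λ f≗g i i<n → cong (ℤ._+ c i) (f≗g i i<n))
  (λ f≗g i i<n → cong (ℤ._- c i) (f≗g i i<n))
  (λ g i _ → ℤ+G.//-rightDividesˡ (c i) (g i))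
  (λ f i _ → ℤ+G.//-rightDividesʳ (c i) (f i))

at : ∀ {n} → Vec ℤ n → ℕ → ℤ
at []      _       = 0ℤ
at (a ∷ x) zero    = a
at (a ∷ x) (suc i) = at x i

lookup≡at : ∀ {n} (x : Vec ℤ n) (i : Fin n) → lookup x i ≡ at x (toℕ i)
lookup≡at (a ∷ x) Fin.zero    = refl
lookup≡at (a ∷ x) (Fin.suc i) = lookup≡at x i

at-tabulate : ∀ n (f : ℕ → ℤ) i → i < n → at (tabulate {n = n} (f ∘ toℕ)) i ≡ f i
at-tabulate (suc n) f zero    _         = refl
at-tabulate (suc n) f (suc i) (s≤s i<n) = at-tabulate n (f ∘ suc) i i<n

vec↔seq : ∀ n → Inverse (≡.setoid (Vec ℤ n)) (Seq n ℤ)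
vec↔seq n = mkInverse at (λ f → tabulate (f ∘ toℕ))
  (λ { refl _ _ → refl })
  (λ f≗g → tabulate-cong (λ i → f≗g (toℕ i) (toℕ<n i)))
  (λ f → at-tabulate n f)
  (λ x → trans (tabulate-cong (sym ∘ lookup≡at x)) (tabulate∘lookup x))

-- Lattice paths through the abscissae of their north steps

northXs : ℕ → List Step → List ℕ
northXs c []      = []
northXs c (N ∷ s) = c ∷ northXs c s
northXs c (E ∷ s) = northXs (suc c) s

pathFrom : ℕ → List ℕ → ℕ → List Step
pathFrom c []       w = replicate (w ∸ c) E
pathFrom c (x ∷ xs) w = replicate (x ∸ c) E ++ N ∷ pathFrom x xs w

Ascending : ℕ → List ℕ → ℕ → Set
Ascending c []       w = c ≤ w
Ascending c (x ∷ xs) w = c ≤ x × Ascending x xs w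

ascending-weaken : ∀ {c} xs {w} → Ascending (suc c) xs w → Ascending c xs w
ascending-weaken []       c<w          = ≤-trans (n≤1+n _) c<w
ascending-weaken (_ ∷ _)  (c<x , asc) = ≤-trans (n≤1+n _) c<x , asc

northXs-ascending : ∀ c s → Ascending c (northXs c s) (c + #E s)
northXs-ascending c []      = m≤m+n c 0
northXs-ascending c (N ∷ s) = ≤-refl , northXs-ascending c s
northXs-ascending c (E ∷ s) rewrite +-suc c (#E s) =
  ascending-weaken (northXs (suc c) s) (northXs-ascending (suc c) s)

length-northXs : ∀ c s → length (northXs c s) ≡ #N s
length-northXs c []      = refl
length-northXs c (N ∷ s) = cong suc (length-northXs c s)
length-northXs c (E ∷ s) = length-northXs (suc c) s

northXs-∷ʳE : ∀ c s → northXs c (s ∷ʳ E) ≡ northXs c s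
northXs-∷ʳE c []      = refl
northXs-∷ʳE c (N ∷ s) = cong (c ∷_) (northXs-∷ʳE c s)
northXs-∷ʳE c (E ∷ s) = northXs-∷ʳE (suc c) s

northXs-east : ∀ c j t → northXs c (replicate j E ++ t) ≡ northXs (c + j) t
northXs-east c zero    t rewrite +-identityʳ c = refl
northXs-east c (suc j) t rewrite +-suc c j = northXs-east (suc c) j t

#N-east : ∀ j t → #N (replicate j E ++ t) ≡ #N t
#N-east zero    t = refl
#N-east (suc j) t = #N-east j t

#E-east : ∀ j t → #E (replicate j E ++ t) ≡ j + #E t
#E-east zero    t = refl
#E-east (suc j) t = cong suc (#E-east j t)

pathFrom-E : ∀ c xs w → Ascending (suc c) xs w → pathFrom c xs w ≡ E ∷ pathFrom (suc c) xs w
pathFrom-E c []      w c<w       rewrite +-∸-assoc 1 c<w = refl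
pathFrom-E c (x ∷ _) w (c<x , _) rewrite +-∸-assoc 1 c<x = refl

pathFrom-northXs : ∀ c s → pathFrom c (northXs c s) (c + #E s) ≡ s
pathFrom-northXs c []      = cong (λ j → replicate j E) (m+n∸m≡n c 0)
pathFrom-northXs c (N ∷ s) rewrite n∸n≡0 c = cong (N ∷_) (pathFrom-northXs c s)
pathFrom-northXs c (E ∷ s) = begin
  pathFrom c (northXs (suc c) s) (c + suc (#E s))     ≡⟨ cong (pathFrom c (northXs (suc c) s)) (+-suc c (#E s)) ⟩
  pathFrom c (northXs (suc c) s) (suc c + #E s)       ≡⟨ pathFrom-E c _ _ (northXs-ascending (suc c) s) ⟩
  E ∷ pathFrom (suc c) (northXs (suc c) s) (suc c + #E s) ≡⟨ cong (E ∷_) (pathFrom-northXs (suc c) s) ⟩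
  E ∷ s                                                ∎
  where open ≡.≡-Reasoning

northXs-pathFrom : ∀ c xs w → Ascending c xs w → northXs c (pathFrom c xs w) ≡ xs
northXs-pathFrom c []       w _ =
  trans (cong (northXs c) (sym (++-identityʳ (replicate (w ∸ c) E)))) (northXs-east c (w ∸ c) [])
northXs-pathFrom c (x ∷ xs) w (c≤x , asc)
  rewrite northXs-east c (x ∸ c) (N ∷ pathFrom x xs w) | m+[n∸m]≡n c≤x =
  cong (x ∷_) (northXs-pathFrom x xs w asc)

#N-pathFrom : ∀ c xs w → #N (pathFrom c xs w) ≡ length xs
#N-pathFrom c []       w = trans (cong #N (sym (++-identityʳ (replicate (w ∸ c) E)))) (#N-east (w ∸ c) [])
#N-pathFrom c (x ∷ xs) w = trans (#N-east (x ∸ c) _) (cong suc (#N-pathFrom x xs w))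

#E-pathFrom : ∀ c xs w → Ascending c xs w → c + #E (pathFrom c xs w) ≡ w
#E-pathFrom c [] w c≤w = begin
  c + #E (replicate (w ∸ c) E)        ≡⟨ cong (λ s → c + #E s) (sym (++-identityʳ (replicate (w ∸ c) E))) ⟩
  c + #E (replicate (w ∸ c) E ++ [])  ≡⟨ cong (_+_ c) (trans (#E-east (w ∸ c) []) (+-identityʳ _)) ⟩
  c + (w ∸ c)                         ≡⟨ m+[n∸m]≡n c≤w ⟩
  w                                   ∎
  where open ≡.≡-Reasoning
#E-pathFrom c (x ∷ xs) w (c≤x , asc) = begin
  c + #E (replicate (x ∸ c) E ++ N ∷ pathFrom x xs w) ≡⟨ cong (_+_ c) (#E-east (x ∸ c) _) ⟩
  c + ((x ∸ c) + #E (pathFrom x xs w))                ≡⟨ sym (+-assoc c _ _) ⟩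
  c + (x ∸ c) + #E (pathFrom x xs w)                  ≡⟨ cong (_+ #E (pathFrom x xs w)) (m+[n∸m]≡n c≤x) ⟩
  x + #E (pathFrom x xs w)                            ≡⟨ #E-pathFrom x xs w asc ⟩
  w                                                   ∎
  where open ≡.≡-Reasoning

nth : List ℕ → ℕ → ℕ
nth []       _       = 0
nth (x ∷ xs) zero    = x
nth (x ∷ xs) (suc i) = nth xs i

nth-applyUpTo : ∀ f n i → i < n → nth (applyUpTo f n) i ≡ f i
nth-applyUpTo f (suc n) zero    _         = refl
nth-applyUpTo f (suc n) (suc i) (s≤s i<n) = nth-applyUpTo (f ∘ suc) n i i<n

applyUpTo-nth : ∀ xs → applyUpTo (nth xs) (length xs) ≡ xs
applyUpTo-nth []       = refl
applyUpTo-nth (x ∷ xs) = cong (x ∷_) (applyUpTo-nth xs)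

applyUpTo-cong : ∀ {A : Set} {f g : ℕ → A} n → f ≗[ n ] g → applyUpTo f n ≡ applyUpTo g n
applyUpTo-cong zero    _   = refl
applyUpTo-cong (suc n) f≗g =
  cong₂ _∷_ (f≗g 0 (s≤s z≤n)) (applyUpTo-cong n (λ i i<n → f≗g (suc i) (s≤s i<n)))

ascending⇒nth-step : ∀ {c} xs {w} → Ascending c xs w →
                     ∀ i → suc i < length xs → nth xs i ≤ nth xs (suc i)
ascending⇒nth-step (_ ∷ [])          _             i       (s≤s ())
ascending⇒nth-step (_ ∷ _ ∷ _)       (_ , x≤y , _) zero    _         = x≤y
ascending⇒nth-step (_ ∷ xs@(_ ∷ _)) (_ , asc)     (suc i) (s≤s i<n) = ascending⇒nth-step xs asc i i<n

applyUpTo-ascending : ∀ {c w} f n → (0 < n → c ≤ f 0) → (∀ i → suc i < n → f i ≤ f (suc i)) →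
                      (∀ i → i < n → f i ≤ w) → c ≤ w → Ascending c (applyUpTo f n) w
applyUpTo-ascending f zero    _  _    _  c≤w = c≤w
applyUpTo-ascending f (suc n) c≤ step ≤w _   = c≤ (s≤s z≤n) ,
  applyUpTo-ascending (f ∘ suc) n (λ 0<n → step 0 (s≤s 0<n)) (λ i i<n → step (suc i) (s≤s i<n))
    (λ i i<n → ≤w (suc i) (s≤s i<n)) (≤w 0 (s≤s z≤n))

module _ (m : ℕ) where

  -- The last field of IsAugDyck m n (p ∷ʳ E) is StepsAbove m 0 0 p.
  StepsAbove : ℕ → ℕ → List Step → Set
  StepsAbove a b s = ∀ q r → q ++ r ≡ s → a + #E q ≤ m * (b + #N q)

  private
    at-start : ∀ {a b} → a + 0 ≤ m * (b + 0) → a ≤ m * b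
    at-start {a} {b} = subst₂ _≤_ (+-identityʳ a) (cong (m *_) (+-identityʳ b))

    to-start : ∀ {a b} → a ≤ m * b → a + 0 ≤ m * (b + 0)
    to-start {a} {b} = subst₂ _≤_ (sym (+-identityʳ a)) (cong (m *_) (sym (+-identityʳ b)))

  stepsAbove-start : ∀ {a b} s → StepsAbove a b s → a ≤ m * b
  stepsAbove-start s above = at-start (above [] s refl)

  stepsAbove-[] : ∀ {a b} → a ≤ m * b → StepsAbove a b []
  stepsAbove-[] a≤ [] [] refl = to-start a≤

  stepsAbove-E⁻ : ∀ {a b} s → StepsAbove a b (E ∷ s) → StepsAbove (suc a) b s
  stepsAbove-E⁻ {a} {b} s above q r refl =
    subst (_≤ m * (b + #N q)) (+-suc a (#E q)) (above (E ∷ q) r refl)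

  stepsAbove-E : ∀ {a b} s → a ≤ m * b → StepsAbove (suc a) b s → StepsAbove a b (E ∷ s)
  stepsAbove-E s a≤ above []      _ _    = to-start a≤
  stepsAbove-E {a} {b} s a≤ above (E ∷ q) r refl =
    subst (_≤ m * (b + #N q)) (sym (+-suc a (#E q))) (above q r refl)

  stepsAbove-N⁻ : ∀ {a b} s → StepsAbove a b (N ∷ s) → StepsAbove a (suc b) s
  stepsAbove-N⁻ {a} {b} s above q r refl =
    subst (λ h → a + #E q ≤ m * h) (+-suc b (#N q)) (above (N ∷ q) r refl)

  stepsAbove-N : ∀ {a b} s → a ≤ m * b → StepsAbove a (suc b) s → StepsAbove a b (N ∷ s)
  stepsAbove-N s a≤ above []      _ _    = to-start a≤
  stepsAbove-N {a} {b} s a≤ above (N ∷ q) r refl =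
    subst (λ h → a + #E q ≤ m * h) (sym (+-suc b (#N q))) (above q r refl)

  stepsAbove-east⁻ : ∀ j {a b} t → StepsAbove a b (replicate j E ++ t) → StepsAbove (a + j) b t
  stepsAbove-east⁻ zero    {a} t above rewrite +-identityʳ a = above
  stepsAbove-east⁻ (suc j) {a} t above rewrite +-suc a j =
    stepsAbove-east⁻ j t (stepsAbove-E⁻ _ above)

  stepsAbove-east : ∀ j {a b} t → StepsAbove (a + j) b t → StepsAbove a b (replicate j E ++ t)
  stepsAbove-east zero    {a} t above rewrite +-identityʳ a = above
  stepsAbove-east (suc j) {a} {b} t above rewrite +-suc a j =
    stepsAbove-E _ (≤-trans (m≤m+n a (suc j)) (subst (_≤ m * b) (sym (+-suc a j)) (stepsAbove-start t above)))
      (stepsAbove-east j t above)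

  NorthXsAbove : ℕ → List ℕ → ℕ → Set
  NorthXsAbove b []       w = w ≤ m * b
  NorthXsAbove b (x ∷ xs) w = x ≤ m * b × NorthXsAbove (suc b) xs w

  stepsAbove⇒northXsAbove : ∀ {c} b xs w → Ascending c xs w →
                            StepsAbove c b (pathFrom c xs w) → NorthXsAbove b xs w
  stepsAbove⇒northXsAbove {c} b [] w c≤w above = subst (_≤ m * b) (m+[n∸m]≡n c≤w)
    (stepsAbove-start [] (stepsAbove-east⁻ (w ∸ c) [] (subst (StepsAbove c b) (sym (++-identityʳ _)) above)))
  stepsAbove⇒northXsAbove {c} b (x ∷ xs) w (c≤x , asc) above =
    stepsAbove-start _ above′ , stepsAbove⇒northXsAbove (suc b) xs w asc (stepsAbove-N⁻ _ above′)
    where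
    above′ : StepsAbove x b (N ∷ pathFrom x xs w)
    above′ = subst (λ a → StepsAbove a b (N ∷ pathFrom x xs w)) (m+[n∸m]≡n c≤x)
               (stepsAbove-east⁻ (x ∸ c) _ above)

  northXsAbove⇒stepsAbove : ∀ {c} b xs w → Ascending c xs w →
                            NorthXsAbove b xs w → StepsAbove c b (pathFrom c xs w)
  northXsAbove⇒stepsAbove {c} b [] w c≤w w≤ = subst (StepsAbove c b) (++-identityʳ _)
    (stepsAbove-east (w ∸ c) [] (stepsAbove-[] (subst (_≤ m * b) (sym (m+[n∸m]≡n c≤w)) w≤)))
  northXsAbove⇒stepsAbove {c} b (x ∷ xs) w (c≤x , asc) (x≤ , above) = stepsAbove-east (x ∸ c) _
    (subst (λ a → StepsAbove a b (N ∷ pathFrom x xs w)) (sym (m+[n∸m]≡n c≤x))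
      (stepsAbove-N _ x≤ (northXsAbove⇒stepsAbove (suc b) xs w asc above)))

  northXsAbove⇒nth : ∀ b xs {w} → NorthXsAbove b xs w → ∀ i → i < length xs → nth xs i ≤ m * (b + i)
  northXsAbove⇒nth b (x ∷ xs) (x≤ , _) zero _ rewrite +-identityʳ b = x≤
  northXsAbove⇒nth b (x ∷ xs) (_ , above) (suc i) (s≤s i<n) rewrite +-suc b i =
    northXsAbove⇒nth (suc b) xs above i i<n

  applyUpTo-northXsAbove : ∀ f n b w → (∀ i → i < n → f i ≤ m * (b + i)) → w ≤ m * (b + n) →
                           NorthXsAbove b (applyUpTo f n) w
  applyUpTo-northXsAbove f zero b w ≤line w≤ rewrite +-identityʳ b = w≤
  applyUpTo-northXsAbove f (suc n) b w ≤line w≤ =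
    subst (λ h → f 0 ≤ m * h) (+-identityʳ b) (≤line 0 (s≤s z≤n)) ,
    applyUpTo-northXsAbove (f ∘ suc) n (suc b) w
      (λ i i<n → subst (λ h → f (suc i) ≤ m * h) (+-suc b i) (≤line (suc i) (s≤s i<n)))
      (subst (λ h → w ≤ m * h) (+-suc b n) w≤)

module DyckSequences (m n : ℕ) where

  DyckSeq : (ℕ → ℕ) → Set
  DyckSeq y = (∀ i → suc i < n → y i ≤ y (suc i)) × (∀ i → i < n → y i ≤ m * i)

  abscissae : List Step → ℕ → ℕ
  abscissae s = nth (northXs 0 s)

  dyckPath : (ℕ → ℕ) → List Step
  dyckPath y = pathFrom 0 (applyUpTo y n) (m * n) ∷ʳ E

  dyck⇒dyckSeq : ∀ s → IsAugDyck m n s → DyckSeq (abscissae s)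
  dyck⇒dyckSeq _ (p , refl , #Np≡n , _ , above) rewrite northXs-∷ʳE 0 p =
    (λ i i<n → ascending⇒nth-step (northXs 0 p) asc i (<length i<n)) ,
    (λ i i<n → northXsAbove⇒nth m 0 (northXs 0 p) xsAbove i (<length i<n))
    where
    <length : ∀ {i} → i < n → i < length (northXs 0 p)
    <length = subst (_ <_) (sym (trans (length-northXs 0 p) #Np≡n))
    asc : Ascending 0 (northXs 0 p) (#E p)
    asc = northXs-ascending 0 p
    xsAbove : NorthXsAbove m 0 (northXs 0 p) (#E p)
    xsAbove = stepsAbove⇒northXsAbove m 0 (northXs 0 p) (#E p) asc
      (subst (StepsAbove m 0 0) (sym (pathFrom-northXs 0 p)) above)

  dyckSeq-ascending : ∀ {y} → DyckSeq y → Ascending 0 (applyUpTo y n) (m * n)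
  dyckSeq-ascending {y} (step , ≤line) = applyUpTo-ascending y n (λ _ → z≤n) step
    (λ i i<n → ≤-trans (≤line i i<n) (*-monoʳ-≤ m (<⇒≤ i<n))) z≤n

  dyckSeq⇒dyck : ∀ y → DyckSeq y → IsAugDyck m n (dyckPath y)
  dyckSeq⇒dyck y dy@(_ , ≤line) =
    pathFrom 0 (applyUpTo y n) (m * n) , refl ,
    trans (#N-pathFrom 0 (applyUpTo y n) (m * n)) (length-applyUpTo y n) ,
    cong (_+ 1) (#E-pathFrom 0 (applyUpTo y n) (m * n) (dyckSeq-ascending dy)) ,
    northXsAbove⇒stepsAbove m 0 (applyUpTo y n) (m * n) (dyckSeq-ascending dy)
      (applyUpTo-northXsAbove m y n 0 (m * n) ≤line ≤-refl)

  abscissae-dyckPath : ∀ y → DyckSeq y → abscissae (dyckPath y) ≗[ n ] y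
  abscissae-dyckPath y dy i i<n
    rewrite northXs-∷ʳE 0 (pathFrom 0 (applyUpTo y n) (m * n))
          | northXs-pathFrom 0 (applyUpTo y n) (m * n) (dyckSeq-ascending dy) = nth-applyUpTo y n i i<n

  dyckPath-abscissae : ∀ s → IsAugDyck m n s → dyckPath (abscissae s) ≡ s
  dyckPath-abscissae _ (p , refl , #Np≡n , #Ep+1≡ , _) = cong (_∷ʳ E) (begin
    pathFrom 0 (applyUpTo (nth (northXs 0 (p ∷ʳ E))) n) (m * n)
      ≡⟨ cong (λ xs → pathFrom 0 (applyUpTo (nth xs) n) (m * n)) (northXs-∷ʳE 0 p) ⟩
    pathFrom 0 (applyUpTo (nth (northXs 0 p)) n) (m * n)
      ≡⟨ cong₂ (λ l w → pathFrom 0 (applyUpTo (nth (northXs 0 p)) l) w)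
               (sym (trans (length-northXs 0 p) #Np≡n)) (sym (+-cancelʳ-≡ _ _ _ #Ep+1≡)) ⟩
    pathFrom 0 (applyUpTo (nth (northXs 0 p)) (length (northXs 0 p))) (#E p)
      ≡⟨ cong (λ xs → pathFrom 0 xs (#E p)) (applyUpTo-nth (northXs 0 p)) ⟩
    pathFrom 0 (northXs 0 p) (#E p)
      ≡⟨ pathFrom-northXs 0 p ⟩
    p ∎)
    where open ≡.≡-Reasoning

  dyckPath-cong : ∀ {y y′} → y ≗[ n ] y′ → dyckPath y ≡ dyckPath y′
  dyckPath-cong y≗y′ = cong (λ xs → pathFrom 0 xs (m * n) ∷ʳ E) (applyUpTo-cong n y≗y′)

  dyckPaths↔dyckSeqs :
    Inverse (Subset (≡.setoid (List Step)) (IsAugDyck m n)) (Subset (Seq n ℕ) DyckSeq)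
  dyckPaths↔dyckSeqs = mkInverse
    (λ (s , ds) → abscissae s , dyck⇒dyckSeq s ds)
    (λ (y , dy) → dyckPath y , dyckSeq⇒dyck y dy)
    (λ s≡s′ i _ → cong (λ s → abscissae s i) s≡s′)
    dyckPath-cong
    (λ (y , dy) → abscissae-dyckPath y dy)
    (λ (s , ds) → dyckPath-abscissae s ds)

SkeletalSeq : ℕ → ℕ → ℕ → (ℕ → ℤ) → Set
SkeletalSeq m n k x =
  (∀ i j → i ≤ j → j < n → x i ℤ.≤ x j) ×
  0ℤ ℤ.≤ x 0 ×
  (∀ i → i < n → n ∸ k ∸ 1 ≤ i → x i ℤ.< + (m * i) ℤ.+ + 1) ×
  (∀ i → i ≤ n ∸ k ∸ 1 → ∃[ j ] j < n × i ≤ j × j ≤ i + k × + (m * j) ℤ.≤ x j)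

ascending⇒monotone : ∀ {n} {x : ℕ → ℤ} → (∀ i → suc i < n → x i ℤ.≤ x (suc i)) →
                     ∀ i j → i ≤ j → j < n → x i ℤ.≤ x j
ascending⇒monotone step i zero    z≤n    _     = ℤ.≤-refl
ascending⇒monotone step i (suc j) i≤1+j 1+j<n with m≤n⇒m<n∨m≡n i≤1+j
... | inj₂ refl  = ℤ.≤-refl
... | inj₁ i<1+j =
  ℤ.≤-trans (ascending⇒monotone step i j (s≤s⁻¹ i<1+j) (<-trans (n<1+n j) 1+j<n)) (step j 1+j<n)

module _ (m n′ k : ℕ) where

  private
    n : ℕ
    n = suc n′

    at≡lookup : ∀ (x : Vec ℤ n) {i} (i<n : i < n) → at x i ≡ lookup x (fromℕ< i<n)
    at≡lookup x i<n = trans (cong (at x) (sym (toℕ-fromℕ< i<n))) (sym (lookup≡at x (fromℕ< i<n)))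

  skeletal⇒skeletalSeq : ∀ {x} → IsSkeletal m n k x → SkeletalSeq m n k (at x)
  skeletal⇒skeletalSeq {x} (mono , p0 , p1 , p2) =
    (λ i j i≤j j<n → let i<n = ≤-<-trans i≤j j<n in
       subst₂ ℤ._≤_ (sym (at≡lookup x i<n)) (sym (at≡lookup x j<n))
         (mono _ _ (subst₂ _≤_ (sym (toℕ-fromℕ< i<n)) (sym (toℕ-fromℕ< j<n)) i≤j))) ,
    subst (0ℤ ℤ.≤_) (lookup≡at x Fin.zero) (p0 Fin.zero refl) ,
    (λ i i<n K≤i → subst₂ (λ a b → a ℤ.< + (m * b) ℤ.+ + 1) (sym (at≡lookup x i<n)) (toℕ-fromℕ< i<n)
       (p1 (fromℕ< i<n) (subst (_ ≤_) (sym (toℕ-fromℕ< i<n)) K≤i))) ,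
    (λ i i≤K → let j , i≤j , j≤i+k , mj≤xj = p2 i i≤K in
       toℕ j , toℕ<n j , i≤j , j≤i+k , subst (+ (m * toℕ j) ℤ.≤_) (lookup≡at x j) mj≤xj)

  skeletalSeq⇒skeletal : ∀ {x} → SkeletalSeq m n k x → IsSkeletal m n k (tabulate (x ∘ toℕ))
  skeletalSeq⇒skeletal {x} (mono , 0≤x0 , p1 , p2) =
    (λ i j i≤j → subst₂ ℤ._≤_ (sym (tab i)) (sym (tab j)) (mono _ _ i≤j (toℕ<n j))) ,
    (λ i i≡0 → subst (+ 0 ℤ.≤_) (sym (trans (tab i) (cong x i≡0))) 0≤x0) ,
    (λ i K≤i → subst (ℤ._< + (m * toℕ i) ℤ.+ + 1) (sym (tab i)) (p1 (toℕ i) (toℕ<n i) K≤i)) ,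
    (λ i i≤K → let j , j<n , i≤j , j≤i+k , mj≤xj = p2 i i≤K in window j<n i≤j j≤i+k mj≤xj)
    where
    tab : ∀ i → lookup (tabulate (x ∘ toℕ)) i ≡ x (toℕ i)
    tab = lookup∘tabulate (x ∘ toℕ)
    window : ∀ {i j} → j < n → i ≤ j → j ≤ i + k → + (m * j) ℤ.≤ x j →
             ∃ λ (j′ : Fin n) → i ≤ toℕ j′ × toℕ j′ ≤ i + k ×
                                + (m * toℕ j′) ℤ.≤ lookup (tabulate (x ∘ toℕ)) j′
    window j<n i≤j j≤i+k mj≤xj with fromℕ< j<n | toℕ-fromℕ< j<n
    ... | j′ | refl = j′ , i≤j , j≤i+k , subst (+ (m * toℕ j′) ℤ.≤_) (sym (tab j′)) mj≤xj

  skeletalVecs↔skeletalSeqs :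
    Inverse (Subset (≡.setoid (Vec ℤ n)) (IsSkeletal m n k)) (Subset (Seq n ℤ) (SkeletalSeq m n k))
  skeletalVecs↔skeletalSeqs =
    restrict (vec↔seq n) (λ {x} → skeletal⇒skeletalSeq {x}) (λ {x} → skeletalSeq⇒skeletal {x})

-- Searches, anchors and periodic functions

greatest≤ : ∀ {P : ℕ → Set} → Decidable P → P 0 →
            ∀ b → ∃[ v ] P v × v ≤ b × (∀ w → w ≤ b → P w → w ≤ v)
greatest≤ P? P0 zero = 0 , P0 , z≤n , λ { _ z≤n _ → z≤n }
greatest≤ {P} P? P0 (suc b) with P? (suc b)
... | yes Pb = suc b , Pb , ≤-refl , λ _ w≤b _ → w≤b
... | no ¬Pb with greatest≤ P? P0 b
...   | v , Pv , v≤b , max = v , Pv , m≤n⇒m≤1+n v≤b , below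
  where
  below : ∀ w → w ≤ suc b → P w → w ≤ v
  below w w≤1+b Pw with m≤n⇒m<n∨m≡n w≤1+b
  ... | inj₁ w<1+b = max w (s≤s⁻¹ w<1+b) Pw
  ... | inj₂ refl  = ⊥-elim (¬Pb Pw)

IsFirstMax : ℕ → (ℕ → ℤ) → ℕ → Set
IsFirstMax n d p = p < n × (∀ i → i < n → d i ℤ.≤ d p) × (∀ i → i < p → d i ℤ.< d p)

firstMax : (ℕ → ℤ) → ℕ → ℕ
firstMax d zero    = 0
firstMax d (suc b) with d (firstMax d b) ℤ.<? d (suc b)
... | yes _ = suc b
... | no  _ = firstMax d b

firstMax-isFirstMax : ∀ d b → IsFirstMax (suc b) d (firstMax d b)
firstMax-isFirstMax d zero = s≤s z≤n , (λ { zero _ → ℤ.≤-refl ; (suc _) (s≤s ()) }) , λ _ ()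
firstMax-isFirstMax d (suc b) with d (firstMax d b) ℤ.<? d (suc b) | firstMax-isFirstMax d b
... | yes dp<db | _ , ≤dp , _ = ≤-refl , ≤db , λ i i<1+b → ℤ.≤-<-trans (≤dp i i<1+b) dp<db
  where
  ≤db : ∀ i → i < suc (suc b) → d i ℤ.≤ d (suc b)
  ≤db i i<2+b with m≤n⇒m<n∨m≡n (s≤s⁻¹ i<2+b)
  ... | inj₁ i<1+b = ℤ.<⇒≤ (ℤ.≤-<-trans (≤dp i i<1+b) dp<db)
  ... | inj₂ refl  = ℤ.≤-refl
... | no dp≮db | p<1+b , ≤dp , first = m<n⇒m<1+n p<1+b , ≤dp′ , first
  where
  ≤dp′ : ∀ i → i < suc (suc b) → d i ℤ.≤ d (firstMax d b)
  ≤dp′ i i<2+b with m≤n⇒m<n∨m≡n (s≤s⁻¹ i<2+b)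
  ... | inj₁ i<1+b = ≤dp i i<1+b
  ... | inj₂ refl  = ℤ.≮⇒≥ dp≮db

isFirstMax-unique : ∀ {n d p p′} → IsFirstMax n d p → IsFirstMax n d p′ → p ≡ p′
isFirstMax-unique {p = p} {p′} (p<n , ≤dp , first) (p′<n , ≤dp′ , first′) with <-cmp p p′
... | tri≈ _ p≡p′ _ = p≡p′
... | tri< p<p′ _ _ = ⊥-elim (ℤ.<⇒≱ (first′ p p<p′) (≤dp p′ p′<n))
... | tri> _ _ p′<p = ⊥-elim (ℤ.<⇒≱ (first p′ p′<p) (≤dp′ p p<n))

isFirstMax-cong : ∀ {n d d′ p} → d ≗[ n ] d′ → IsFirstMax n d p → IsFirstMax n d′ p
isFirstMax-cong d≗d′ (p<n , ≤dp , first) =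
  p<n ,
  (λ i i<n → subst₂ ℤ._≤_ (d≗d′ i i<n) (d≗d′ _ p<n) (≤dp i i<n)) ,
  (λ i i<p → subst₂ ℤ._<_ (d≗d′ i (<-trans i<p p<n)) (d≗d′ _ p<n) (first i i<p))

DropsAtMost : ℕ → (ℕ → ℤ) → Set
DropsAtMost m F = ∀ t → F t ℤ.≤ F (suc t) ℤ.+ + m

dropsAtMost-iterate : ∀ {m F} → DropsAtMost m F → ∀ t j → F t ℤ.≤ F (t + j) ℤ.+ + (m * j)
dropsAtMost-iterate {m} {F} drops t zero rewrite +-identityʳ t | *-zeroʳ m =
  ℤ.≤-reflexive (sym (ℤ.+-identityʳ (F t)))
dropsAtMost-iterate {m} {F} drops t (suc j) = begin
  F t                                          ≤⟨ dropsAtMost-iterate drops t j ⟩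
  F (t + j) ℤ.+ + (m * j)                      ≤⟨ ℤ.+-monoˡ-≤ (+ (m * j)) (drops (t + j)) ⟩
  F (suc (t + j)) ℤ.+ + m ℤ.+ + (m * j)        ≡⟨ ℤ.+-assoc (F (suc (t + j))) (+ m) (+ (m * j)) ⟩
  F (suc (t + j)) ℤ.+ + (m + m * j)            ≡⟨ cong₂ (λ s c → F s ℤ.+ + c) (sym (+-suc t j)) (sym (*-suc m j)) ⟩
  F (t + suc j) ℤ.+ + (m * suc j)              ∎
  where open ℤ.≤-Reasoning

module _ (k : ℕ) where

  NegativeBefore : (ℕ → ℤ) → ℕ → Set
  NegativeBefore F w = ∀ {t} → t < w → w ≤ t + suc k → F t ℤ.< 0ℤ

  Anchor : (ℕ → ℤ) → ℕ → Set
  Anchor F w = 0ℤ ℤ.≤ F w × NegativeBefore F w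

  anchor? : ∀ F → Decidable (Anchor F)
  anchor? F w = 0ℤ ℤ.≤? F w ×-dec allUpTo? (λ t → w ≤? t + suc k →-dec F t ℤ.<? 0ℤ) w

  anchor-cong : ∀ {F G w} → (∀ t → F t ≡ G t) → Anchor F w → Anchor G w
  anchor-cong F≗G (0≤Fw , neg) =
    subst (0ℤ ℤ.≤_) (F≗G _) 0≤Fw , λ t<w w≤ → subst (ℤ._< 0ℤ) (F≗G _) (neg t<w w≤)

  negativeBefore-+ : ∀ {F} s → (∀ j → j < suc k → F (s + j) ℤ.< 0ℤ) → NegativeBefore F (s + suc k)
  negativeBefore-+ {F} s negative {t} t<s+1+k s+1+k≤t+1+k
    with m≤n⇒∃[o]m+o≡n (+-cancelʳ-≤ (suc k) s t s+1+k≤t+1+k)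
  ... | j , s+j≡t = subst (λ u → F u ℤ.< 0ℤ) s+j≡t
    (negative j (+-cancelˡ-< s j (suc k) (subst (_< s + suc k) (sym s+j≡t) t<s+1+k)))

  IsGreatestAnchor : (ℕ → ℤ) → ℕ → Set
  IsGreatestAnchor F v = Anchor F v × (∀ w → Anchor F w → w ≤ v)

  greatestAnchor : ∀ {F} b → 0ℤ ℤ.≤ F 0 → (∀ w → Anchor F w → w ≤ b) → ∃ (IsGreatestAnchor F)
  greatestAnchor {F} b 0≤F0 bounded with greatest≤ (anchor? F) (0≤F0 , λ ()) b
  ... | v , anchor , _ , max = v , anchor , λ w Aw → max w (bounded w Aw) Aw

  greatestAnchor-unique : ∀ {F G v v′} → (∀ t → F t ≡ G t) →
                          IsGreatestAnchor F v → IsGreatestAnchor G v′ → v ≡ v′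
  greatestAnchor-unique F≗G (Av , maxF) (Av′ , maxG) =
    ≤-antisym (maxG _ (anchor-cong F≗G Av)) (maxF _ (anchor-cong (sym ∘ F≗G) Av′))

  anchor-after : ∀ {F} d s → NegativeBefore F s → 0ℤ ℤ.≤ F (s + d) → ∃[ w ] s ≤ w × Anchor F w
  anchor-after {F} d s neg 0≤F with 0ℤ ℤ.≤? F s
  ... | yes 0≤Fs = s , ≤-refl , 0≤Fs , neg
  anchor-after {F} zero s neg 0≤F | no 0≰Fs = ⊥-elim (0≰Fs (subst (λ t → 0ℤ ℤ.≤ F t) (+-identityʳ s) 0≤F))
  anchor-after {F} (suc d) s neg 0≤F | no 0≰Fs
    with anchor-after d (suc s) neg′ (subst (λ t → 0ℤ ℤ.≤ F t) (+-suc s d) 0≤F)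
    where
    neg′ : NegativeBefore F (suc s)
    neg′ {t} t<1+s 1+s≤ with m≤n⇒m<n∨m≡n (s≤s⁻¹ t<1+s)
    ... | inj₁ t<s  = neg t<s (≤-trans (n≤1+n s) 1+s≤)
    ... | inj₂ refl = ℤ.≰⇒> 0≰Fs
  ... | w , 1+s≤w , Aw = w , ≤-trans (n≤1+n s) 1+s≤w , Aw

module Periodic (n : ℕ) ⦃ n≢0 : NonZero n ⦄ where

  Periodic : (ℕ → ℤ) → Set
  Periodic F = ∀ t → F (t + n) ≡ ℤ.suc (F t)

  extend : (ℕ → ℤ) → ℕ → ℤ
  extend e t = e (t % n) ℤ.+ + (t / n)

  extend-periodic : ∀ e → Periodic (extend e)
  extend-periodic e t = begin
    e ((t + n) % n) ℤ.+ + ((t + n) / n)  ≡⟨ cong₂ (λ r q → e r ℤ.+ + q) ([m+n]%n≡m%n t n) [t+n]/n≡1+t/n ⟩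
    e (t % n) ℤ.+ (1ℤ ℤ.+ + (t / n))     ≡⟨ ℤ+.x∙yz≈y∙xz (e (t % n)) 1ℤ (+ (t / n)) ⟩
    ℤ.suc (extend e t)                   ∎
    where
    open ≡.≡-Reasoning
    [t+n]/n≡1+t/n : (t + n) / n ≡ 1 + t / n
    [t+n]/n≡1+t/n = trans (m/n≡1+[m∸n]/n (m≤n+m n t)) (cong (λ s → 1 + s / n) (m+n∸n≡m t n))

  periodic-+* : ∀ F → Periodic F → ∀ t q → F (t + q * n) ≡ F t ℤ.+ + q
  periodic-+* F periodic t zero = trans (cong F (+-identityʳ t)) (sym (ℤ.+-identityʳ (F t)))
  periodic-+* F periodic t (suc q) = begin
    F (t + (n + q * n))    ≡⟨ cong F (trans (cong (_+_ t) (+-comm n (q * n))) (sym (+-assoc t (q * n) n))) ⟩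
    F (t + q * n + n)      ≡⟨ periodic (t + q * n) ⟩
    ℤ.suc (F (t + q * n))  ≡⟨ cong ℤ.suc (periodic-+* F periodic t q) ⟩
    ℤ.suc (F t ℤ.+ + q)    ≡⟨ ℤ+.x∙yz≈y∙xz (F t) 1ℤ (+ q) ⟨
    F t ℤ.+ + suc q        ∎
    where open ≡.≡-Reasoning

  periodic-split : ∀ F → Periodic F → ∀ t → F t ≡ F (t % n) ℤ.+ + (t / n)
  periodic-split F periodic t = trans (cong F (m≡m%n+[m/n]*n t n)) (periodic-+* F periodic (t % n) (t / n))

  extend-< : ∀ e {t} → t < n → extend e t ≡ e t
  extend-< e {t} t<n = trans (cong₂ (λ r q → e r ℤ.+ + q) (m<n⇒m%n≡m t<n) (m<n⇒m/n≡0 t<n)) (ℤ.+-identityʳ (e t))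

  extend-cong : ∀ {e e′} → e ≗[ n ] e′ → ∀ t → extend e t ≡ extend e′ t
  extend-cong e≗e′ t = cong (ℤ._+ + (t / n)) (e≗e′ (t % n) (m%n<n t n))

  extend-shift : ∀ F → Periodic F → ∀ c a t → extend (λ i → F (c + i) ℤ.+ a) t ≡ F (c + t) ℤ.+ a
  extend-shift F periodic c a t = begin
    F (c + t % n) ℤ.+ a ℤ.+ + (t / n)       ≡⟨ ℤ+.xy∙z≈xz∙y (F (c + t % n)) a (+ (t / n)) ⟩
    F (c + t % n) ℤ.+ + (t / n) ℤ.+ a       ≡⟨ cong (ℤ._+ a) (periodic-+* F periodic (c + t % n) (t / n)) ⟨
    F (c + t % n + t / n * n) ℤ.+ a         ≡⟨ cong (λ s → F s ℤ.+ a) (+-assoc c (t % n) (t / n * n)) ⟩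
    F (c + (t % n + t / n * n)) ℤ.+ a       ≡⟨ cong (λ s → F (c + s) ℤ.+ a) (m≡m%n+[m/n]*n t n) ⟨
    F (c + t) ℤ.+ a                         ∎
    where open ≡.≡-Reasoning

  periodic-dropsAtMost : ∀ {m} F → Periodic F → (∀ t → t < n → F t ℤ.≤ F (suc t) ℤ.+ + m) → DropsAtMost m F
  periodic-dropsAtMost {m} F periodic drops t = begin
    F t                                               ≡⟨ periodic-split F periodic t ⟩
    F (t % n) ℤ.+ + (t / n)                           ≤⟨ ℤ.+-monoˡ-≤ (+ (t / n)) (drops (t % n) (m%n<n t n)) ⟩
    F (suc (t % n)) ℤ.+ + m ℤ.+ + (t / n)             ≡⟨ ℤ+.xy∙z≈xz∙y (F (suc (t % n))) (+ m) (+ (t / n)) ⟩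
    F (suc (t % n)) ℤ.+ + (t / n) ℤ.+ + m             ≡⟨ cong (ℤ._+ + m) (periodic-+* F periodic (suc (t % n)) (t / n)) ⟨
    F (suc (t % n) + t / n * n) ℤ.+ + m               ≡⟨ cong (λ s → F (suc s) ℤ.+ + m) (m≡m%n+[m/n]*n t n) ⟨
    F (suc t) ℤ.+ + m                                 ∎
    where open ℤ.≤-Reasoning

  extend-dropsAtMost : ∀ {m e} → (∀ i → suc i < n → e i ℤ.≤ e (suc i) ℤ.+ + m) → e (pred n) ℤ.≤ e 0 →
                       DropsAtMost m (extend e)
  extend-dropsAtMost {m} {e} drops last≤first = periodic-dropsAtMost (extend e) (extend-periodic e) base
    where
    base : ∀ t → t < n → extend e t ℤ.≤ extend e (suc t) ℤ.+ + m
    base t t<n with m≤n⇒m<n∨m≡n t<n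
    ... | inj₁ 1+t<n =
      subst₂ (λ a b → a ℤ.≤ b ℤ.+ + m) (sym (extend-< e t<n)) (sym (extend-< e 1+t<n)) (drops t 1+t<n)
    ... | inj₂ refl = begin
      extend e t                   ≡⟨ extend-< e t<n ⟩
      e t                          ≤⟨ last≤first ⟩
      e 0                          ≤⟨ ℤ.i≤suc[i] (e 0) ⟩
      ℤ.suc (e 0)                  ≤⟨ ℤ.i≤i+j (ℤ.suc (e 0)) (+ m) ⟩
      ℤ.suc (e 0) ℤ.+ + m          ≡⟨ cong (λ x → ℤ.suc x ℤ.+ + m) (extend-< e (s≤s z≤n)) ⟨
      ℤ.suc (extend e 0) ℤ.+ + m   ≡⟨ cong (ℤ._+ + m) (extend-periodic e 0) ⟨
      extend e n ℤ.+ + m           ∎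
      where open ℤ.≤-Reasoning

  negative⇒quotient< : ∀ {m} F → Periodic F → DropsAtMost m F → 0ℤ ℤ.≤ F 0 → ∀ {t} → F t ℤ.< 0ℤ →
                       t / n < m * (t % n)
  negative⇒quotient< {m} F periodic drops 0≤F0 {t} Ft<0 = ℤ.drop‿+<+ (begin-strict
    + (t / n)                                  ≤⟨ ℤ.+-monoˡ-≤ (+ (t / n)) 0≤F0 ⟩
    F 0 ℤ.+ + (t / n)                          ≡⟨ periodic-+* F periodic 0 (t / n) ⟨
    F (t / n * n)                              ≤⟨ dropsAtMost-iterate drops (t / n * n) (t % n) ⟩
    F (t / n * n + t % n) ℤ.+ + (m * (t % n))  ≡⟨ cong (λ s → F s ℤ.+ + (m * (t % n))) [t/n]n+t%n≡t ⟩
    F t ℤ.+ + (m * (t % n))                    <⟨ ℤ.+-monoˡ-< (+ (m * (t % n))) Ft<0 ⟩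
    + (m * (t % n))                            ∎)
    where
    open ℤ.≤-Reasoning
    [t/n]n+t%n≡t : t / n * n + t % n ≡ t
    [t/n]n+t%n≡t = trans (+-comm (t / n * n) (t % n)) (sym (m≡m%n+[m/n]*n t n))

  negative-bound : ∀ {m} F → Periodic F → DropsAtMost m F → 0ℤ ℤ.≤ F 0 →
                   ∀ {t} → F t ℤ.< 0ℤ → t < m * n * n
  negative-bound {m} F periodic drops 0≤F0 {t} Ft<0 = begin-strict
    t                  ≡⟨ m≡m%n+[m/n]*n t n ⟩
    t % n + t / n * n  <⟨ +-monoˡ-< (t / n * n) (m%n<n t n) ⟩
    suc (t / n) * n    ≤⟨ *-monoˡ-≤ n q<m*n ⟩
    m * n * n          ∎
    where
    open ≤-Reasoning
    q<m*n : t / n < m * n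
    q<m*n = <-≤-trans (negative⇒quotient< F periodic drops 0≤F0 Ft<0) (*-monoʳ-≤ m (<⇒≤ (m%n<n t n)))

  anchor-bound : ∀ {m k} F → Periodic F → DropsAtMost m F → 0ℤ ℤ.≤ F 0 →
                 ∀ {w} → NegativeBefore k F w → w ≤ m * n * n
  anchor-bound F periodic drops 0≤F0 {zero}  _   = z≤n
  anchor-bound {k = k} F periodic drops 0≤F0 {suc w} neg =
    negative-bound F periodic drops 0≤F0 (neg ≤-refl (subst (suc w ≤_) (sym (+-suc w k)) (s≤s (m≤m+n w k))))

  negativeBefore-periodic : ∀ {k} F → Periodic F → ∀ {w} → NegativeBefore k F (w + n) → NegativeBefore k F w
  negativeBefore-periodic {k} F periodic {w} neg {t} t<w w≤ =
    ℤ.≤-<-trans (ℤ.i≤suc[i] (F t)) (subst (ℤ._< 0ℤ) (periodic t)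
      (neg (+-monoˡ-< n t<w) (subst (w + n ≤_) (xy∙z≈xz∙y t (suc k) n) (+-monoˡ-≤ n w≤))))

-- Dyck and skeletal excess sequences

module Excess (m n′ k : ℕ) (k≤n′ : k ≤ n′) where

  n : ℕ
  n = suc n′

  open Periodic n

  K : ℕ
  K = n ∸ k ∸ 1

  private
    K+[1+k]≡n : K + suc k ≡ n
    K+[1+k]≡n = begin
      n ∸ k ∸ 1 + suc k   ≡⟨ cong (λ x → x ∸ 1 + suc k) (+-∸-assoc 1 k≤n′) ⟩
      n′ ∸ k + suc k      ≡⟨ +-suc (n′ ∸ k) k ⟩
      suc (n′ ∸ k + k)    ≡⟨ cong suc (m∸n+n≡m k≤n′) ⟩
      n                   ∎
      where open ≡.≡-Reasoning

    K≤⇒n≤ : ∀ {i} → K ≤ i → n ≤ i + suc k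
    K≤⇒n≤ {i} K≤i = subst (_≤ i + suc k) K+[1+k]≡n (+-monoˡ-≤ (suc k) K≤i)

    n≤⇒K≤ : ∀ {i} → n ≤ i + suc k → K ≤ i
    n≤⇒K≤ {i} n≤ = +-cancelʳ-≤ (suc k) K i (subst (_≤ i + suc k) (sym K+[1+k]≡n) n≤)

    ≤K⇒≤n : ∀ {i} → i ≤ K → i + suc k ≤ n
    ≤K⇒≤n {i} i≤K = subst (i + suc k ≤_) K+[1+k]≡n (+-monoˡ-≤ (suc k) i≤K)

    ≤n⇒≤K : ∀ {i} → i + suc k ≤ n → i ≤ K
    ≤n⇒≤K {i} ≤n = +-cancelʳ-≤ (suc k) i K (subst (i + suc k ≤_) (sym K+[1+k]≡n) ≤n)

    -- The points v + i with K ≤ i < n lie one period after the k + 1 points before v.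
    window-shift : ∀ {t v i} → t + n ≡ v + i → i < n → K ≤ i → t < v × v ≤ t + suc k
    window-shift {t} {v} {i} t+n≡v+i i<n K≤i =
      +-cancelʳ-< n t v (subst (_< v + n) (sym t+n≡v+i) (+-monoʳ-< v i<n)) ,
      +-cancelʳ-≤ n v (t + suc k) (begin
        v + n            ≤⟨ +-monoʳ-≤ v (K≤⇒n≤ K≤i) ⟩
        v + (i + suc k)  ≡⟨ +-assoc v i (suc k) ⟨
        v + i + suc k    ≡⟨ cong (_+ suc k) t+n≡v+i ⟨
        t + n + suc k    ≡⟨ xy∙z≈xz∙y t n (suc k) ⟩
        t + suc k + n    ∎)
      where open ≤-Reasoning

    window-unshift : ∀ {t v} → t < v → v ≤ t + suc k → ∃[ i ] t + n ≡ v + i × i < n × K ≤ i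
    window-unshift {t} {v} t<v v≤t+1+k = t + n ∸ v , t+n≡v+i , i<n , n≤⇒K≤ n≤i+1+k
      where
      open ≤-Reasoning
      t+n≡v+i : t + n ≡ v + (t + n ∸ v)
      t+n≡v+i = sym (m+[n∸m]≡n (≤-trans v≤t+1+k (+-monoʳ-≤ t (s≤s k≤n′))))
      i<n : t + n ∸ v < n
      i<n = +-cancelˡ-< v (t + n ∸ v) n (subst (_< v + n) t+n≡v+i (+-monoˡ-< n t<v))
      n≤i+1+k : n ≤ t + n ∸ v + suc k
      n≤i+1+k = +-cancelˡ-≤ v n (t + n ∸ v + suc k) (begin
        v + n                        ≤⟨ +-monoˡ-≤ n v≤t+1+k ⟩
        t + suc k + n                ≡⟨ xy∙z≈xz∙y t (suc k) n ⟩
        t + n + suc k                ≡⟨ cong (_+ suc k) t+n≡v+i ⟩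
        v + (t + n ∸ v) + suc k      ≡⟨ +-assoc v (t + n ∸ v) (suc k) ⟩
        v + (t + n ∸ v + suc k)      ∎)

    K≤n′ : K ≤ n′
    K≤n′ = n≤⇒K≤ (subst (n ≤_) (sym (+-suc n′ k)) (s≤s (m≤m+n n′ k)))

    roundUp : ∀ v → ∃[ p ] ∃[ q ] p < n × v + p ≡ q * n
    roundUp zero = 0 , 0 , s≤s z≤n , refl
    roundUp (suc v) with roundUp v
    ... | zero  , q , _       , v+0≡qn = n′ , suc q , ≤-refl ,
      cong suc (trans (+-comm v n′) (cong (_+_ n′) (trans (sym (+-identityʳ v)) v+0≡qn)))
    ... | suc p , q , 1+p<n , v+1+p≡qn = p , q , <-trans (n<1+n p) 1+p<n , trans (sym (+-suc v p)) v+1+p≡qn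

  DyckExcess : (ℕ → ℤ) → Set
  DyckExcess e =
    (∀ i → suc i < n → e i ℤ.≤ e (suc i) ℤ.+ + m) × e 0 ≡ 0ℤ × (∀ i → i < n → e i ℤ.≤ 0ℤ)

  SkeletalExcess : (ℕ → ℤ) → Set
  SkeletalExcess d =
    (∀ i → suc i < n → d i ℤ.≤ d (suc i) ℤ.+ + m) × 0ℤ ℤ.≤ d 0 ×
    (∀ i → i < n → K ≤ i → d i ℤ.≤ 0ℤ) ×
    (∀ i → i ≤ K → ∃[ j ] i ≤ j × j ≤ i + k × 0ℤ ℤ.≤ d j)

  toDyck : (ℕ → ℤ) → ℕ → ℤ
  toDyck d j = extend d (firstMax d n′ + j) ℤ.- d (firstMax d n′)

  toDyck-cong : ∀ {d d′} → d ≗[ n ] d′ → toDyck d ≗[ n ] toDyck d′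
  toDyck-cong {d} {d′} d≗d′ j _ = trans (cong (λ p → extend d (p + j) ℤ.- d p) firstMax≡)
    (cong₂ ℤ._-_ (extend-cong d≗d′ (firstMax d′ n′ + j)) (d≗d′ _ (proj₁ (firstMax-isFirstMax d′ n′))))
    where
    firstMax≡ : firstMax d n′ ≡ firstMax d′ n′
    firstMax≡ = isFirstMax-unique (isFirstMax-cong d≗d′ (firstMax-isFirstMax d n′)) (firstMax-isFirstMax d′ n′)

  module FromDyck {e} (de : DyckExcess e) where

    private
      e-drops : ∀ i → suc i < n → e i ℤ.≤ e (suc i) ℤ.+ + m
      e-drops = proj₁ de
      e0≡0 : e 0 ≡ 0ℤ
      e0≡0 = proj₁ (proj₂ de)
      e≤0 : ∀ i → i < n → e i ℤ.≤ 0ℤ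
      e≤0 = proj₂ (proj₂ de)

    ê : ℕ → ℤ
    ê = extend e

    ê-periodic : Periodic ê
    ê-periodic = extend-periodic e

    ê-drops : DropsAtMost m ê
    ê-drops = extend-dropsAtMost e-drops (subst (e n′ ℤ.≤_) (sym e0≡0) (e≤0 n′ ≤-refl))

    ê0≡0 : ê 0 ≡ 0ℤ
    ê0≡0 = trans (extend-< e (s≤s z≤n)) e0≡0

    ê≤0 : ∀ {t} → t < n → ê t ℤ.≤ 0ℤ
    ê≤0 {t} t<n = subst (ℤ._≤ 0ℤ) (sym (extend-< e t<n)) (e≤0 t t<n)

    ê≤quotient : ∀ t → ê t ℤ.≤ + (t / n)
    ê≤quotient t = ℤ.+-monoˡ-≤ (+ (t / n)) (e≤0 (t % n) (m%n<n t n))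

    ê<quotient : ∀ {t q} → t < q * n → ê t ℤ.< + q
    ê<quotient {t} t<qn = ℤ.≤-<-trans (ê≤quotient t) (ℤ.+<+ (m<n*o⇒m/o<n t<qn))

    ê-multiple : ∀ q → ê (q * n) ≡ + q
    ê-multiple q = trans (periodic-+* ê ê-periodic 0 q) (cong (ℤ._+ + q) ê0≡0)

    ê-greatestAnchor : ∃ (IsGreatestAnchor k ê)
    ê-greatestAnchor = greatestAnchor k (m * n * n) (ℤ.≤-reflexive (sym ê0≡0))
      (λ _ (_ , neg) → anchor-bound ê ê-periodic ê-drops (ℤ.≤-reflexive (sym ê0≡0)) neg)

    v : ℕ
    v = proj₁ ê-greatestAnchor

    d : ℕ → ℤ
    d i = ê (v + i)

    private
      v-anchor : Anchor k ê v
      v-anchor = proj₁ (proj₂ ê-greatestAnchor)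
      v-greatest : ∀ w → Anchor k ê w → w ≤ v
      v-greatest = proj₂ (proj₂ ê-greatestAnchor)

    d-tail : ∀ i → i < n → K ≤ i → d i ℤ.≤ 0ℤ
    d-tail i i<n K≤i with v + i <? n
    ... | yes v+i<n = ê≤0 v+i<n
    ... | no  v+i≮n with m≤n⇒∃[o]m+o≡n (≮⇒≥ v+i≮n)
    ...   | t , n+t≡v+i with trans (+-comm t n) n+t≡v+i
    ...     | t+n≡v+i with window-shift t+n≡v+i i<n K≤i
    ...       | t<v , v≤t+1+k = subst (ℤ._≤ 0ℤ) (trans (sym (ê-periodic t)) (cong ê t+n≡v+i))
                                  (ℤ.i<j⇒suc[i]≤j (proj₂ v-anchor t<v v≤t+1+k))

    private
      0≤ê[v+n] : 0ℤ ℤ.≤ ê (v + n)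
      0≤ê[v+n] = ℤ.≤-trans (proj₁ v-anchor)
        (ℤ.≤-trans (ℤ.i≤suc[i] (ê v)) (ℤ.≤-reflexive (sym (ê-periodic v))))

    -- If d were negative on i, …, i + k, the first nonnegative point after v + i + k
    -- (there is one up to v + n) would be an anchor beyond v.
    d-window : ∀ i → i ≤ K → ∃[ j ] i ≤ j × j ≤ i + k × 0ℤ ℤ.≤ d j
    d-window i i≤K with anyUpTo? (λ j → 0ℤ ℤ.≤? d (i + j)) (suc k)
    ... | yes (j , j<1+k , 0≤dj) = i + j , m≤m+n i j , +-monoʳ-≤ i (s≤s⁻¹ j<1+k) , 0≤dj
    ... | no none with anchor-after k (n ∸ (i + suc k)) (v + i + suc k) window-negative 0≤ê-later
      where
      window-negative : NegativeBefore k ê (v + i + suc k)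
      window-negative = negativeBefore-+ k {ê} (v + i) λ j j<1+k →
        ℤ.≰⇒> (λ 0≤ê → none (j , j<1+k , subst (λ s → 0ℤ ℤ.≤ ê s) (+-assoc v i j) 0≤ê))
      0≤ê-later : 0ℤ ℤ.≤ ê (v + i + suc k + (n ∸ (i + suc k)))
      0≤ê-later = subst (λ s → 0ℤ ℤ.≤ ê s)
        (sym (trans (cong (_+ (n ∸ (i + suc k))) (+-assoc v i (suc k)))
                    (trans (+-assoc v (i + suc k) _) (cong (_+_ v) (m+[n∸m]≡n (≤K⇒≤n i≤K))))))
        0≤ê[v+n]
    ... | w , v+i+1+k≤w , w-anchor =
      ⊥-elim (<⇒≱ (<-≤-trans (m<m+n v (s≤s z≤n)) (≤-trans (+-monoˡ-≤ (suc k) (m≤m+n v i)) v+i+1+k≤w))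
                  (v-greatest w w-anchor))

    skeletal : SkeletalExcess d
    skeletal =
      (λ i _ → subst (λ s → ê (v + i) ℤ.≤ ê s ℤ.+ + m) (sym (+-suc v i)) (ê-drops (v + i))) ,
      subst (λ s → 0ℤ ℤ.≤ ê s) (sym (+-identityʳ v)) (proj₁ v-anchor) ,
      d-tail ,
      d-window

    private
      p q : ℕ
      p = proj₁ (roundUp v)
      q = proj₁ (proj₂ (roundUp v))
      p<n : p < n
      p<n = proj₁ (proj₂ (proj₂ (roundUp v)))
      v+p≡qn : v + p ≡ q * n
      v+p≡qn = proj₂ (proj₂ (proj₂ (roundUp v)))

    dp≡q : d p ≡ + q
    dp≡q = trans (cong ê v+p≡qn) (ê-multiple q)

    d-firstMax : IsFirstMax n d p
    d-firstMax =
      p<n ,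
      (λ i i<n → subst (d i ℤ.≤_) (sym dp≡q)
         (ℤ.≤-trans (ê≤quotient (v + i)) (ℤ.+≤+ (s≤s⁻¹ (m<n*o⇒m/o<n (v+i<[1+q]n i<n)))))) ,
      (λ i i<p → subst (d i ℤ.<_) (sym dp≡q) (ê<quotient (subst (v + i <_) v+p≡qn (+-monoʳ-< v i<p))))
      where
      v+i<[1+q]n : ∀ {i} → i < n → v + i < suc q * n
      v+i<[1+q]n {i} i<n = begin-strict
        v + i          <⟨ +-monoʳ-< v i<n ⟩
        v + n          ≤⟨ +-monoˡ-≤ n (m≤m+n v p) ⟩
        v + p + n      ≡⟨ cong (_+ n) v+p≡qn ⟩
        q * n + n      ≡⟨ +-comm (q * n) n ⟩
        suc q * n      ∎
        where open ≤-Reasoning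

    toDyck-d : toDyck d ≗[ n ] e
    toDyck-d j j<n = begin
      toDyck d j                ≡⟨ cong (λ p′ → extend d (p′ + j) ℤ.- d p′) firstMax≡p ⟩
      extend d (p + j) ℤ.- d p  ≡⟨ cong₂ ℤ._-_ (extend-d (p + j)) dp≡q ⟩
      ê (v + (p + j)) ℤ.- + q   ≡⟨ cong (λ s → ê s ℤ.- + q) v+[p+j]≡j+qn ⟩
      ê (j + q * n) ℤ.- + q     ≡⟨ cong (ℤ._- + q) (periodic-+* ê ê-periodic j q) ⟩
      ê j ℤ.+ + q ℤ.- + q       ≡⟨ ℤ+G.//-rightDividesʳ (+ q) (ê j) ⟩
      ê j                       ≡⟨ extend-< e j<n ⟩
      e j                       ∎
      where
      open ≡.≡-Reasoning
      firstMax≡p : firstMax d n′ ≡ p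
      firstMax≡p = isFirstMax-unique (firstMax-isFirstMax d n′) d-firstMax
      extend-d : ∀ t → extend d t ≡ ê (v + t)
      extend-d t = trans (extend-cong (λ i _ → sym (ℤ.+-identityʳ (d i))) t)
        (trans (extend-shift ê ê-periodic v 0ℤ t) (ℤ.+-identityʳ _))
      v+[p+j]≡j+qn : v + (p + j) ≡ j + q * n
      v+[p+j]≡j+qn = trans (sym (+-assoc v p j)) (trans (cong (_+ j) v+p≡qn) (+-comm (q * n) j))

  toSkeletal : ∀ {e} → DyckExcess e → ℕ → ℤ
  toSkeletal de = FromDyck.d de

  module FromSkeletal {d} (sd : SkeletalExcess d) where

    private
      d-drops : ∀ i → suc i < n → d i ℤ.≤ d (suc i) ℤ.+ + m
      d-drops = proj₁ sd
      0≤d0 : 0ℤ ℤ.≤ d 0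
      0≤d0 = proj₁ (proj₂ sd)
      d-tail : ∀ i → i < n → K ≤ i → d i ℤ.≤ 0ℤ
      d-tail = proj₁ (proj₂ (proj₂ sd))
      d-window : ∀ i → i ≤ K → ∃[ j ] i ≤ j × j ≤ i + k × 0ℤ ℤ.≤ d j
      d-window = proj₂ (proj₂ (proj₂ sd))

    d̂ : ℕ → ℤ
    d̂ = extend d

    d̂-periodic : Periodic d̂
    d̂-periodic = extend-periodic d

    d̂-drops : DropsAtMost m d̂
    d̂-drops = extend-dropsAtMost d-drops (ℤ.≤-trans (d-tail n′ ≤-refl K≤n′) 0≤d0)

    p : ℕ
    p = firstMax d n′

    M : ℤ
    M = d p

    private
      p-first : IsFirstMax n d p
      p-first = firstMax-isFirstMax d n′

    d̂≤M : ∀ j → j < n → d̂ (p + j) ℤ.≤ M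
    d̂≤M j j<n with p + j <? n
    ... | yes p+j<n = subst (ℤ._≤ M) (sym (extend-< d p+j<n)) (proj₁ (proj₂ p-first) (p + j) p+j<n)
    ... | no  p+j≮n with m≤n⇒∃[o]m+o≡n (≮⇒≥ p+j≮n)
    ...   | t , n+t≡p+j =
      subst (ℤ._≤ M) (sym d̂[p+j]≡1+dt) (ℤ.i<j⇒suc[i]≤j (proj₂ (proj₂ p-first) t t<p))
      where
      t+n≡p+j : t + n ≡ p + j
      t+n≡p+j = trans (+-comm t n) n+t≡p+j
      t<p : t < p
      t<p = +-cancelʳ-< n t p (subst (_< p + n) (sym t+n≡p+j) (+-monoʳ-< p j<n))
      d̂[p+j]≡1+dt : d̂ (p + j) ≡ ℤ.suc (d t)
      d̂[p+j]≡1+dt = trans (cong d̂ (sym t+n≡p+j))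
        (trans (d̂-periodic t) (cong ℤ.suc (extend-< d (<-trans t<p (proj₁ p-first)))))

    e : ℕ → ℤ
    e = toDyck d

    dyck : DyckExcess e
    dyck = e-drops , e0≡0 , λ j j<n → ℤ.i≤j⇒i-j≤0 (d̂≤M j j<n)
      where
      e-drops : ∀ j → suc j < n → e j ℤ.≤ e (suc j) ℤ.+ + m
      e-drops j _ = subst (e j ℤ.≤_)
        (trans (ℤ+.xy∙z≈xz∙y (d̂ (suc (p + j))) (+ m) (ℤ.- M))
               (cong (λ s → d̂ s ℤ.- M ℤ.+ + m) (sym (+-suc p j))))
        (ℤ.+-monoˡ-≤ (ℤ.- M) (d̂-drops (p + j)))
      e0≡0 : e 0 ≡ 0ℤ
      e0≡0 = trans (cong (λ s → d̂ s ℤ.- M) (+-identityʳ p))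
        (trans (cong (ℤ._- M) (extend-< d (proj₁ p-first))) (ℤ.+-inverseʳ M))

    ê : ℕ → ℤ
    ê = extend e

    private
      0≤M : 0ℤ ℤ.≤ M
      0≤M = ℤ.≤-trans 0≤d0 (proj₁ (proj₂ p-first) 0 (s≤s z≤n))

      μ : ℕ
      μ = ℤ.∣ M ∣

      +μ≡M : + μ ≡ M
      +μ≡M = ℤ.0≤i⇒+∣i∣≡i 0≤M

      p≤[μ]n : ∀ μ′ → + μ′ ≡ M → p ≤ μ′ * n
      p≤[μ]n zero     +0≡M =
        ≮⇒≥ (λ 0<p → ℤ.<⇒≱ (proj₂ (proj₂ p-first) 0 0<p) (subst (ℤ._≤ d 0) +0≡M 0≤d0))
      p≤[μ]n (suc μ′) _    = ≤-trans (<⇒≤ (proj₁ p-first)) (m≤m+n n (μ′ * n))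

    v* : ℕ
    v* = μ * n ∸ p

    ê-v*+ : ∀ i → i < n → ê (v* + i) ≡ d i
    ê-v*+ i i<n = begin
      ê (v* + i)                   ≡⟨ extend-shift d̂ d̂-periodic p (ℤ.- M) (v* + i) ⟩
      d̂ (p + (v* + i)) ℤ.- M       ≡⟨ cong (λ s → d̂ s ℤ.- M) p+[v*+i]≡i+μn ⟩
      d̂ (i + μ * n) ℤ.- M          ≡⟨ cong (ℤ._- M) (periodic-+* d̂ d̂-periodic i μ) ⟩
      d̂ i ℤ.+ + μ ℤ.- M            ≡⟨ cong₂ (λ a b → a ℤ.+ + μ ℤ.- b) (extend-< d i<n) (sym +μ≡M) ⟩
      d i ℤ.+ + μ ℤ.- + μ          ≡⟨ ℤ+G.//-rightDividesʳ (+ μ) (d i) ⟩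
      d i                          ∎
      where
      open ≡.≡-Reasoning
      p+[v*+i]≡i+μn : p + (v* + i) ≡ i + μ * n
      p+[v*+i]≡i+μn = trans (sym (+-assoc p v* i))
        (trans (cong (_+ i) (m+[n∸m]≡n (p≤[μ]n μ +μ≡M))) (+-comm (μ * n) i))

    v*-anchor : Anchor k ê v*
    v*-anchor =
      subst (λ s → 0ℤ ℤ.≤ ê s) (+-identityʳ v*) (subst (0ℤ ℤ.≤_) (sym (ê-v*+ 0 (s≤s z≤n))) 0≤d0) ,
      negative
      where
      negative : NegativeBefore k ê v*
      negative {t} t<v* v*≤t+1+k with window-unshift t<v* v*≤t+1+k
      ... | i , t+n≡v*+i , i<n , K≤i = ℤ.suc[i]≤j⇒i<j (subst (ℤ._≤ 0ℤ) di≡1+êt (d-tail i i<n K≤i))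
        where
        di≡1+êt : d i ≡ ℤ.suc (ê t)
        di≡1+êt = trans (sym (ê-v*+ i i<n)) (trans (cong ê (sym t+n≡v*+i)) (extend-periodic e t))

    -- A window ending in (v*, v* + k + 1] contains v*; a later one contains a
    -- nonnegative point by the window condition on d.
    no-negativeBefore-within : ∀ {w} → v* < w → w ≤ v* + n → ¬ NegativeBefore k ê w
    no-negativeBefore-within {w} v*<w w≤v*+n negative with w ≤? v* + suc k
    ... | yes w≤v*+1+k = ℤ.<⇒≱ (negative v*<w w≤v*+1+k) (proj₁ v*-anchor)
    ... | no  w≰v*+1+k = clash (m≤n⇒∃[o]m+o≡n (<⇒≤ (≰⇒> w≰v*+1+k)))
      where
      clash : ∃[ i ] v* + suc k + i ≡ w → ⊥
      clash (i , v*+1+k+i≡w) = nonnegative-in-window (d-window i i≤K)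
        where
        v*+[1+k+i]≡w : v* + (suc k + i) ≡ w
        v*+[1+k+i]≡w = trans (sym (+-assoc v* (suc k) i)) v*+1+k+i≡w
        i≤K : i ≤ K
        i≤K = ≤n⇒≤K (subst (_≤ n) (+-comm (suc k) i)
                (+-cancelˡ-≤ v* (suc k + i) n (subst (_≤ v* + n) (sym v*+[1+k+i]≡w) w≤v*+n)))
        nonnegative-in-window : (∃[ j ] i ≤ j × j ≤ i + k × 0ℤ ℤ.≤ d j) → ⊥
        nonnegative-in-window (j , i≤j , j≤i+k , 0≤dj) =
          ℤ.<⇒≱ (negative v*+j<w w≤v*+j+1+k) (subst (0ℤ ℤ.≤_) (sym (ê-v*+ j j<n)) 0≤dj)
          where
          j<i+1+k : j < i + suc k
          j<i+1+k = subst (j <_) (sym (+-suc i k)) (s≤s j≤i+k)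
          j<n : j < n
          j<n = <-≤-trans j<i+1+k (≤K⇒≤n i≤K)
          v*+j<w : v* + j < w
          v*+j<w = subst (v* + j <_) v*+[1+k+i]≡w
            (+-monoʳ-< v* (subst (j <_) (+-comm i (suc k)) j<i+1+k))
          w≤v*+j+1+k : w ≤ v* + j + suc k
          w≤v*+j+1+k = subst₂ _≤_ v*+[1+k+i]≡w
            (trans (cong (_+_ v*) (+-comm (suc k) j)) (sym (+-assoc v* j (suc k))))
            (+-monoʳ-≤ v* (+-monoʳ-≤ (suc k) i≤j))

    no-negativeBefore-after : ∀ w → v* < w → ¬ NegativeBefore k ê w
    no-negativeBefore-after = <-rec (λ w → v* < w → ¬ NegativeBefore k ê w) step
      where
      step : ∀ w → (∀ {w′} → w′ < w → v* < w′ → ¬ NegativeBefore k ê w′) →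
             v* < w → ¬ NegativeBefore k ê w
      step w rec v*<w negative with w ≤? v* + n
      ... | yes w≤v*+n = no-negativeBefore-within v*<w w≤v*+n negative
      ... | no  w≰v*+n with m≤n⇒∃[o]m+o≡n (≤-trans (m≤n+m n v*) (<⇒≤ (≰⇒> w≰v*+n)))
      ...   | w′ , n+w′≡w = rec w′<w v*<w′
        (negativeBefore-periodic ê (extend-periodic e) (subst (NegativeBefore k ê) (sym w′+n≡w) negative))
        where
        w′+n≡w : w′ + n ≡ w
        w′+n≡w = trans (+-comm w′ n) n+w′≡w
        w′<w : w′ < w
        w′<w = subst (w′ <_) w′+n≡w (m<m+n w′ (s≤s z≤n))
        v*<w′ : v* < w′
        v*<w′ = +-cancelʳ-< n v* w′ (subst (v* + n <_) (sym w′+n≡w) (≰⇒> w≰v*+n))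

    v*-greatest : IsGreatestAnchor k ê v*
    v*-greatest = v*-anchor , λ w (_ , negative) → ≮⇒≥ (λ v*<w → no-negativeBefore-after w v*<w negative)

    toSkeletal-e : toSkeletal dyck ≗[ n ] d
    toSkeletal-e i i<n = trans (cong (λ v → ê (v + i)) v≡v*) (ê-v*+ i i<n)
      where
      v≡v* : FromDyck.v dyck ≡ v*
      v≡v* = greatestAnchor-unique k (λ _ → refl) (proj₂ (FromDyck.ê-greatestAnchor dyck)) v*-greatest

  toSkeletal-cong : ∀ {e e′} (de : DyckExcess e) (de′ : DyckExcess e′) →
                    e ≗[ n ] e′ → toSkeletal de ≗[ n ] toSkeletal de′
  toSkeletal-cong {e} de de′ e≗e′ i _ =
    trans (cong (λ v → extend e (v + i)) v≡v′) (extend-cong e≗e′ (FromDyck.v de′ + i))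
    where
    v≡v′ : FromDyck.v de ≡ FromDyck.v de′
    v≡v′ = greatestAnchor-unique k (extend-cong e≗e′)
             (proj₂ (FromDyck.ê-greatestAnchor de)) (proj₂ (FromDyck.ê-greatestAnchor de′))

  dyckExcess↔skeletalExcess :
    Inverse (Subset (Seq n ℤ) DyckExcess) (Subset (Seq n ℤ) SkeletalExcess)
  dyckExcess↔skeletalExcess = mkInverse
    (λ (e , de) → toSkeletal de , FromDyck.skeletal de)
    (λ (d , sd) → toDyck d , FromSkeletal.dyck sd)
    (λ {x} {x′} → toSkeletal-cong (proj₂ x) (proj₂ x′))
    toDyck-cong
    (λ (d , sd) → FromSkeletal.toSkeletal-e sd)
    (λ (e , de) → FromDyck.toDyck-d de)

  private
    drops⇒ascends : ∀ {a} b i → a ℤ.≤ b ℤ.+ + m → a ℤ.+ + (m * i) ℤ.≤ b ℤ.+ + (m * suc i)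
    drops⇒ascends {a} b i a≤b+m = subst (a ℤ.+ + (m * i) ℤ.≤_)
      (trans (ℤ.+-assoc b (+ m) (+ (m * i))) (cong (λ c → b ℤ.+ + c) (sym (*-suc m i))))
      (ℤ.+-monoˡ-≤ (+ (m * i)) a≤b+m)

    ascends⇒drops : ∀ {a b} i → a ℤ.≤ b → a ℤ.- + (m * i) ℤ.≤ b ℤ.- + (m * suc i) ℤ.+ + m
    ascends⇒drops {a} {b} i a≤b = subst (a ℤ.- + (m * i) ℤ.≤_) (sym (begin
      b ℤ.- + (m * suc i) ℤ.+ + m          ≡⟨ cong (λ c → b ℤ.- + c ℤ.+ + m) (*-suc m i) ⟩
      b ℤ.- (+ m ℤ.+ + (m * i)) ℤ.+ + m    ≡⟨ x-[y+z]+y≡x-z b (+ m) (+ (m * i)) ⟩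
      b ℤ.- + (m * i)                      ∎))
      (ℤ.+-monoˡ-≤ (ℤ.- + (m * i)) a≤b)
      where
      open ≡.≡-Reasoning
      x-[y+z]+y≡x-z : ∀ x y z → x ℤ.- (y ℤ.+ z) ℤ.+ y ≡ x ℤ.- z
      x-[y+z]+y≡x-z = solve-∀

    dyckExcess-lower : ∀ {e} → DyckExcess e → ∀ i → i < n → 0ℤ ℤ.≤ e i ℤ.+ + (m * i)
    dyckExcess-lower {e} (_ , e0≡0 , _) zero _ rewrite e0≡0 | *-zeroʳ m = ℤ.≤-refl
    dyckExcess-lower {e} de@(e-drops , _ , _) (suc i) 1+i<n =
      ℤ.≤-trans (dyckExcess-lower de i (<-trans (n<1+n i) 1+i<n))
                (drops⇒ascends (e (suc i)) i (e-drops i 1+i<n))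

  open DyckSequences m n using (DyckSeq)

  dyckSeq⇒dyckExcess : ∀ {y} → DyckSeq y → DyckExcess (λ i → + y i ℤ.- + (m * i))
  dyckSeq⇒dyckExcess {y} (ascend , ≤line) =
    (λ i 1+i<n → ascends⇒drops i (ℤ.+≤+ (ascend i 1+i<n))) ,
    e0≡0 ,
    (λ i i<n → ℤ.i≤j⇒i-j≤0 (ℤ.+≤+ (≤line i i<n)))
    where
    y0≡0 : y 0 ≡ 0
    y0≡0 = n≤0⇒n≡0 (subst (y 0 ≤_) (*-zeroʳ m) (≤line 0 (s≤s z≤n)))
    e0≡0 : + y 0 ℤ.- + (m * 0) ≡ 0ℤ
    e0≡0 rewrite y0≡0 | *-zeroʳ m = refl

  abscissaeOf : (ℕ → ℤ) → ℕ → ℕ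
  abscissaeOf e i = ℤ.∣ e i ℤ.+ + (m * i) ∣

  private
    +abscissaeOf : ∀ {e} → DyckExcess e → ∀ i → i < n → + abscissaeOf e i ≡ e i ℤ.+ + (m * i)
    +abscissaeOf de i i<n = ℤ.0≤i⇒+∣i∣≡i (dyckExcess-lower de i i<n)

  dyckExcess⇒dyckSeq : ∀ {e} → DyckExcess e → DyckSeq (abscissaeOf e)
  dyckExcess⇒dyckSeq {e} de@(e-drops , _ , e≤0) =
    (λ i 1+i<n → ℤ.drop‿+≤+ (subst₂ ℤ._≤_
       (sym (+abscissaeOf de i (<-trans (n<1+n i) 1+i<n))) (sym (+abscissaeOf de (suc i) 1+i<n))
       (drops⇒ascends (e (suc i)) i (e-drops i 1+i<n)))) ,
    (λ i i<n → ℤ.drop‿+≤+ (subst (ℤ._≤ + (m * i)) (sym (+abscissaeOf de i i<n))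
       (ℤ.+-monoˡ-≤ (+ (m * i)) (e≤0 i i<n))))

  dyckSeqs↔dyckExcess :
    Inverse (Subset (Seq n ℕ) DyckSeq) (Subset (Seq n ℤ) DyckExcess)
  dyckSeqs↔dyckExcess = mkInverse
    (λ (y , dy) → (λ i → + y i ℤ.- + (m * i)) , dyckSeq⇒dyckExcess dy)
    (λ (e , de) → abscissaeOf e , dyckExcess⇒dyckSeq de)
    (λ y≗y′ i i<n → cong (λ a → + a ℤ.- + (m * i)) (y≗y′ i i<n))
    (λ e≗e′ i i<n → cong (λ a → ℤ.∣ a ℤ.+ + (m * i) ∣) (e≗e′ i i<n))
    (λ (e , de) i i<n →
       trans (cong (ℤ._- + (m * i)) (+abscissaeOf de i i<n)) (ℤ+G.//-rightDividesʳ (+ (m * i)) (e i)))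
    (λ (y , dy) i i<n → cong ℤ.∣_∣ (ℤ+G.//-rightDividesˡ (+ (m * i)) (+ y i)))

  skeletalExcess⇒skeletalSeq : ∀ {d} → SkeletalExcess d → SkeletalSeq m n k (λ i → d i ℤ.+ + (m * i))
  skeletalExcess⇒skeletalSeq {d} (d-drops , 0≤d0 , d-tail , d-window) =
    ascending⇒monotone (λ i 1+i<n → drops⇒ascends (d (suc i)) i (d-drops i 1+i<n)) ,
    subst (λ c → 0ℤ ℤ.≤ d 0 ℤ.+ + c) (sym (*-zeroʳ m))
      (subst (0ℤ ℤ.≤_) (sym (ℤ.+-identityʳ (d 0))) 0≤d0) ,
    (λ i i<n K≤i →
       ℤ.≤-<-trans (ℤ.+-monoˡ-≤ (+ (m * i)) (d-tail i i<n K≤i)) (ℤ.+<+ (m<m+n (m * i) (s≤s z≤n)))) ,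
    (λ i i≤K → let j , i≤j , j≤i+k , 0≤dj = d-window i i≤K in
       j , ≤-<-trans j≤i+k (subst (_≤ n) (+-suc i k) (≤K⇒≤n i≤K)) , i≤j , j≤i+k ,
       ℤ.+-monoˡ-≤ (+ (m * j)) 0≤dj)

  skeletalSeq⇒skeletalExcess : ∀ {x} → SkeletalSeq m n k x → SkeletalExcess (λ i → x i ℤ.- + (m * i))
  skeletalSeq⇒skeletalExcess {x} (mono , 0≤x0 , x-tail , x-window) =
    (λ i 1+i<n → ascends⇒drops i (mono i (suc i) (n≤1+n i) 1+i<n)) ,
    ℤ.i≤j⇒0≤j-i (subst (λ c → + c ℤ.≤ x 0) (sym (*-zeroʳ m)) 0≤x0) ,
    (λ i i<n K≤i → ℤ.i≤j⇒i-j≤0 (<+1⇒≤ (x-tail i i<n K≤i))) ,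
    (λ i i≤K → let j , _ , i≤j , j≤i+k , mj≤xj = x-window i i≤K in
       j , i≤j , j≤i+k , ℤ.i≤j⇒0≤j-i mj≤xj)
    where
    <+1⇒≤ : ∀ {a b} → a ℤ.< + b ℤ.+ 1ℤ → a ℤ.≤ + b
    <+1⇒≤ {a} {b} a<b+1 =
      subst (a ℤ.≤_) (trans (cong ℤ.pred (ℤ.+-comm (+ b) 1ℤ)) (ℤ.pred-suc (+ b))) (ℤ.i<j⇒i≤pred[j] a<b+1)

  skeletalExcess↔skeletalSeqs :
    Inverse (Subset (Seq n ℤ) SkeletalExcess) (Subset (Seq n ℤ) (SkeletalSeq m n k))
  skeletalExcess↔skeletalSeqs = restrict (translate n (λ i → + (m * i)))
    (λ {d} → skeletalExcess⇒skeletalSeq {d}) (λ {x} → skeletalSeq⇒skeletalExcess {x})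

theorem6p3 : (m n k : ℕ) → 1 ≤ m → 1 ≤ n → k ≤ n ∸ 1 →
    SameCard (IsAugDyck m n) (IsSkeletal m n k)
theorem6p3 m zero     k _ ()  _
theorem6p3 m (suc n′) k _ _ k≤n′ = sameCard
  ( dyckPaths↔dyckSeqs
  ⨾ dyckSeqs↔dyckExcess
  ⨾ dyckExcess↔skeletalExcess
  ⨾ skeletalExcess↔skeletalSeqs
  ⨾ Symmetry.inverse (skeletalVecs↔skeletalSeqs m n′ k))
  where
  open DyckSequences m (suc n′) using (dyckPaths↔dyckSeqs)
  open Excess m n′ k k≤n′
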